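{- Let $G=(V,E,(p_e)_{e\in E})$ be a stochastic graph, $K\subseteq V$, and $l$ an integer. For every edge $e_i\in E$ with parameter $p_i$, $$R_{K,l}(G)=p_{i}\,R_{K_{i},l-1}(G\cdot e_{i}) + (1-p_{i})\,R_{K,l}(G-e_{i}),$$ where $K_i=\pi(K)$ is the image of $K$ in $G\cdot e_i$.
   Context: A graph $G=(V,E)$ consists of a finite node set $V$ and a finite set $E$ of edges, each edge being a pair $(\{a,b\},n)$ with $a,b\in V$ (possibly $a=b$) and $n\in\mathbb{N}$, where distinct edges have distinct labels $n$. A stochastic graph assigns to each edge $e$ an independent Bernoulli random variable with parameter $p_e\in[0,1]$ (edge operative with probability $p_e$). A state is a function $\mathcal{E}:E\to\{0,1\}$, with $\#\mathcal{E}=\#\mathcal{E}^{ -1}(1)$ its number of operative edges. Given $K\subseteq V$, a state is a $K$-PathSet if all of $K$ lies in the node set of a single connected component of the graph $(V,\mathcal{E}^{ -1}(1))$. The constrained $l$-energy $K$-reliability is $R_{K,l}(G)=P(\mathcal{E}\text{ is a }K\text{ -PathSet and }\#\mathcal{E}\le l)$ for the random state $\mathcal{E}$ (so it is $0$ when $l<0$). For an edge $e=(\{v,w\},n)$: the deletion is $G-e=(V,E\setminus\{e\})$; the contraction $G\cdot e$ has node set $V/\!\sim$, where $a\sim b$ iff $a=b$ or $\{a,b\}=\{v,w\}$, with quotient map $\pi$, and edge set $\{(\{\pi(a),\pi(b)\},n) : (\{a,b\},n)\in E\setminus\{e\}\}$. Both are stochastic graphs with edge parameters inherited from $G$; the distinguished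 set in $G-e$ is $K$ and in $G\cdot e$ is $\pi(K)$. -}

module Defs where

open import Level using (Level)
open import Data.Nat using (ℕ; zero; suc)
open import Data.Bool using (Bool; true; false; _∧_; if_then_else_)
open import Data.Fin using (Fin; punchOut)
open import Data.Fin.Properties using (_≟_)
import Data.Fin.Properties as FinP
open import Data.Integer as Int using (ℤ; +_)
open import Data.List using (List; []; _∷_; [_]; map; _++_; foldr; length; lookup; removeAt)
open import Data.List.Relation.Unary.Any using (Any; here; there)
open import Data.List.Relation.Unary.All using (All; all?)
open import Data.List.Relation.Unary.AllPairs using (AllPairs)
open import Data.Vec using (Vec; []; _∷_)
open import Data.Product using (Σ; ∃; _×_; _,_; proj₁; proj₂)
open import Data.Sum using (_⊎_; inj₁; inj₂)
open import Relation.Nullary using (Dec; yes; no; does; ¬_)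
open import Relation.Nullary.Decidable using (map′; _×-dec_; _⊎-dec_)
open import Relation.Binary.PropositionalEquality using (_≡_; _≢_; refl; sym)
open import Relation.Binary.Construct.Closure.ReflexiveTransitive
  using (Star; ε; _◅_; _◅◅_)
import Relation.Binary.Construct.Closure.ReflexiveTransitive as Star
open import Algebra.Bundles using (CommutativeRing)

private variable
  a : Level
  A : Set a
  n : ℕ

-- Graphs.  Nodes are Fin n; an edge is ({u,v}, label) carrying its
-- Bernoulli parameter p.  The edge set is a list of edges.

record Edge (A : Set a) (n : ℕ) : Set a where
  constructor edge
  field
    u     : Fin n
    v     : Fin n
    label : ℕ
    prob  : A
open Edge public

record SGraph (A : Set a) : Set a where
  constructor graph
  field
    nodes : ℕ
    edges : List (Edge A nodes)
open SGraph public

DistinctLabels : {a : Level} {A : Set a} → SGraph A → Set a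
DistinctLabels G = AllPairs (λ e f → label e ≢ label f) (edges G)

Adj : List (Edge A n) → Fin n → Fin n → Set _
Adj F x y = Any (λ e → (u e ≡ x × v e ≡ y) ⊎ (u e ≡ y × v e ≡ x)) F

Connected : List (Edge A n) → Fin n → Fin n → Set _
Connected F = Star (Adj F)

-- auxiliary recursive characterisation, used only to decide Connected
Conn : List (Edge A n) → Fin n → Fin n → Set
Conn []      x y = x ≡ y
Conn (e ∷ F) x y = Conn F x y ⊎ ((Conn F x (u e) × Conn F (v e) y) ⊎ (Conn F x (v e) × Conn F (u e) y))

conn? : (F : List (Edge A n)) → (x y : Fin n) → Dec (Conn F x y)
conn? []      x y = x ≟ y
conn? (e ∷ F) x y = conn? F x y ⊎-dec ((conn? F x (u e) ×-dec conn? F (v e) y) ⊎-dec (conn? F x (v e) ×-dec conn? F (u e) y))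

private
  weaken : {e : Edge A n} {F : List (Edge A n)} {x y : Fin n} → Connected F x y → Connected (e ∷ F) x y
  weaken = Star.map there

  sound : (F : List (Edge A n)) {x y : Fin n} → Conn F x y → Connected F x y
  sound []      refl = ε
  sound (e ∷ F) (inj₁ c) = weaken (sound F c)
  sound (e ∷ F) (inj₂ (inj₁ (c₁ , c₂))) = weaken (sound F c₁) ◅◅ (here (inj₁ (refl , refl)) ◅ weaken (sound F c₂))
  sound (e ∷ F) (inj₂ (inj₂ (c₁ , c₂))) = weaken (sound F c₁) ◅◅ (here (inj₂ (refl , refl)) ◅ weaken (sound F c₂))

  complete : (F : List (Edge A n)) {x y : Fin n} → Connected F x y → Conn F x y
  complete []      ε = refl
  complete []      (() ◅ _)
  complete (e ∷ F) {x} ε = inj₁ (complete F ε)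
  complete (e ∷ F) (there xc ◅ rest) with complete (e ∷ F) rest
  ... | inj₁ d = inj₁ (complete F ((xc ◅ ε) ◅◅ sound F d))
  ... | inj₂ (inj₁ (cu , vy)) = inj₂ (inj₁ (complete F ((xc ◅ ε) ◅◅ sound F cu) , vy))
  ... | inj₂ (inj₂ (cv , uy)) = inj₂ (inj₂ (complete F ((xc ◅ ε) ◅◅ sound F cv) , uy))
  complete (e ∷ F) (here (inj₁ (refl , refl)) ◅ rest) with complete (e ∷ F) rest
  ... | inj₁ d = inj₂ (inj₁ (complete F ε , d))
  ... | inj₂ (inj₁ (cu , vy)) = inj₂ (inj₁ (complete F ε , vy))
  ... | inj₂ (inj₂ (cv , uy)) = inj₁ uy
  complete (e ∷ F) (here (inj₂ (refl , refl)) ◅ rest) with complete (e ∷ F) rest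
  ... | inj₁ d = inj₂ (inj₂ (complete F ε , d))
  ... | inj₂ (inj₁ (cu , vy)) = inj₁ vy
  ... | inj₂ (inj₂ (cv , uy)) = inj₂ (inj₂ (complete F ε , uy))

connected? : (F : List (Edge A n)) → (x y : Fin n) → Dec (Connected F x y)
connected? F x y = map′ (sound F) (complete F) (conn? F x y)

-- States: a state of the edge list E is a vector of booleans, one per
-- edge (true = operative).

State : List (Edge A n) → Set
State E = Vec Bool (length E)

operative : (E : List (Edge A n)) → State E → List (Edge A n)
operative []      []          = []
operative (e ∷ E) (true ∷ s)  = e ∷ operative E s
operative (e ∷ E) (false ∷ s) = operative E s

#on : {m : ℕ} → Vec Bool m → ℕ
#on []          = 0
#on (true ∷ s)  = suc (#on s)
#on (false ∷ s) = #on s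

-- K-PathSet: all of K lies in a single connected component of
-- (V, operative edges), i.e. some node c is connected to every k ∈ K.
KPathSet : (E : List (Edge A n)) → State E → List (Fin n) → Set _
KPathSet {n = n} E s K = ∃ λ (c : Fin n) → All (Connected (operative E s) c) K

kPathSet? : (E : List (Edge A n)) (s : State E) (K : List (Fin n)) → Dec (KPathSet E s K)
kPathSet? E s K = FinP.any? (λ c → all? (connected? (operative E s) c) K)

allStates : (m : ℕ) → List (Vec Bool m)
allStates zero    = [ [] ]
allStates (suc m) = map (true ∷_) (allStates m) ++ map (false ∷_) (allStates m)

delete : (G : SGraph A) → Fin (length (edges G)) → SGraph A
delete G i = graph (nodes G) (removeAt (edges G) i)

-- the quotient map Fin (suc m) → Fin m identifying x with y (x ≢ y)
merge : {m : ℕ} (x y : Fin (suc m)) → x ≢ y → Fin (suc m) → Fin m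
merge x y x≢y z with z ≟ y
... | yes _   = punchOut {i = y} {j = x} (λ eq → x≢y (sym eq))
... | no z≢y  = punchOut {i = y} {j = z} (λ eq → z≢y (sym eq))

-- V/~ where a ~ b iff a = b or {a,b} = {x,y}, with its quotient map π
quotient : (x y : Fin n) → Σ ℕ (λ m → Fin n → Fin m)
quotient {n = n} x y with x ≟ y
... | yes _ = n , (λ z → z)
quotient {n = suc m} x y | no x≢y = m , merge x y x≢y

mapEdge : {n m : ℕ} → (Fin n → Fin m) → Edge A n → Edge A m
mapEdge π (edge x y l p) = edge (π x) (π y) l p

contractQuot : (G : SGraph A) → Fin (length (edges G)) → Σ ℕ (λ m → Fin (nodes G) → Fin m)
contractQuot G i = quotient (u (lookup (edges G) i)) (v (lookup (edges G) i))

contractMap : (G : SGraph A) (i : Fin (length (edges G))) → Fin (nodes G) → Fin (proj₁ (contractQuot G i))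
contractMap G i = proj₂ (contractQuot G i)

contract : (G : SGraph A) → Fin (length (edges G)) → SGraph A
contract G i = graph (proj₁ (contractQuot G i)) (map (mapEdge (contractMap G i)) (removeAt (edges G) i))

module Reliability {c ℓ : Level} (R : CommutativeRing c ℓ) where
  open CommutativeRing R

  weight : {n : ℕ} (E : List (Edge Carrier n)) → State E → Carrier
  weight []      []          = 1#
  weight (e ∷ E) (true ∷ s)  = prob e * weight E s
  weight (e ∷ E) (false ∷ s) = (1# - prob e) * weight E s

  sumR : List Carrier → Carrier
  sumR = foldr _+_ 0#

  Rel : (G : SGraph Carrier) → List (Fin (nodes G)) → ℤ → Carrier
  Rel G K l = sumR (map term (allStates (length (edges G))))
    where
      term : State (edges G) → Carrier
      term s = if does (kPathSet? (edges G) s K) ∧ does ((+ #on s) Int.≤? l)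
               then weight (edges G) s else 0#

-- Split the sum defining R_{K,l}(G) according to the state of e_i.  States with e_i
-- failed are exactly the states of G - e_i, with the same operative edges and the
-- same count, and their weight picks up the factor 1 - p_i.  States with e_i operative
-- are in bijection with the states of G · e_i; they have one more operative edge,
-- weight factor p_i, and K lies in one component of G using e_i iff π(K) lies in
-- one component of G · e_i, because π identifies exactly the endpoints of e_i.
module Submission where

open import Defs
open import Level using (Level)
open import Function using (_∘_; id; _⇔_; mk⇔)
open import Function.Construct.Composition using (_⇔-∘_)
open import Data.Nat using (ℕ; zero; suc)
open import Data.Bool using (Bool; true; false; _∧_; if_then_else_)
open import Data.Fin using (Fin; zero; suc; punchIn)
import Data.Fin.Properties as FinP
open import Data.Integer as ℤ using (ℤ; +_; 1ℤ) renaming (_-_ to _-ℤ_)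
import Data.Integer.Properties as ℤP
open import Data.List using (List; []; _∷_; map; _++_; length; lookup; removeAt)
open import Data.List.Properties using (map-++; map-∘)
open import Data.List.Relation.Unary.Any using (here; there)
open import Data.List.Relation.Unary.All as All using (All)
import Data.List.Relation.Unary.All.Properties as AllP
open import Data.List.Relation.Binary.Permutation.Propositional
  using (_↭_; ↭-refl; ↭-reflexive; ↭-sym; ↭-trans; prep; swap)
open import Data.List.Relation.Binary.Permutation.Propositional.Properties
  using (Any-resp-↭)
open import Data.Vec using (Vec; []; _∷_)
open import Data.Product using (∃; ∃₂; _×_; _,_; proj₂)
open import Data.Sum using (_⊎_; inj₁; inj₂)
open import Data.Empty using (⊥-elim)
open import Relation.Nullary using (yes; no; does)
open import Relation.Nullary.Decidable using (does-⇔)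
open import Relation.Binary.Core using (_⇒_)
open import Relation.Binary.PropositionalEquality as ≡
  using (_≡_; _≢_; refl; cong; cong₂; subst)
open import Relation.Binary.Construct.Closure.ReflexiveTransitive
  using (ε; _◅_; _◅◅_)
import Relation.Binary.Construct.Closure.ReflexiveTransitive as Star
open import Algebra.Bundles using (CommutativeRing)

private variable
  a : Level
  A : Set a
  n m : ℕ

-- KPathSet E s K unfolds to Spans (operative E s) K.
Spans : List (Edge A n) → List (Fin n) → Set _
Spans {n = n} F K = ∃ λ (c : Fin n) → All (Connected F c) K

Connected-↭ : {F F′ : List (Edge A n)} → F ↭ F′ → Connected F ⇒ Connected F′
Connected-↭ F↭F′ = Star.map (Any-resp-↭ F↭F′)

Spans-↭ : {F F′ : List (Edge A n)} {K : List (Fin n)} → F ↭ F′ → Spans F K ⇔ Spans F′ K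
Spans-↭ F↭F′ = mk⇔ (λ (c , cK) → c , All.map (Connected-↭ F↭F′) cK)
                   (λ (c , cK) → c , All.map (Connected-↭ (↭-sym F↭F′)) cK)

insertAt : (E : List (Edge A n)) (i : Fin (length E)) → Bool → State (removeAt E i) → State E
insertAt (e ∷ E) zero    b s       = b ∷ s
insertAt (e ∷ E) (suc i) b (c ∷ s) = c ∷ insertAt E i b s

#on-insertAt : (E : List (Edge A n)) (i : Fin (length E)) (b : Bool) (s : State (removeAt E i)) →
               #on (insertAt E i b s) ≡ #on (b ∷ s)
#on-insertAt (e ∷ E) zero    b     s           = refl
#on-insertAt (e ∷ E) (suc i) true  (true ∷ s)  = cong suc (#on-insertAt E i true s)
#on-insertAt (e ∷ E) (suc i) false (true ∷ s)  = cong suc (#on-insertAt E i false s)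
#on-insertAt (e ∷ E) (suc i) true  (false ∷ s) = #on-insertAt E i true s
#on-insertAt (e ∷ E) (suc i) false (false ∷ s) = #on-insertAt E i false s

operative-insertAt-false : (E : List (Edge A n)) (i : Fin (length E)) (s : State (removeAt E i)) →
                           operative E (insertAt E i false s) ≡ operative (removeAt E i) s
operative-insertAt-false (e ∷ E) zero    s           = refl
operative-insertAt-false (e ∷ E) (suc i) (true ∷ s)  = cong (e ∷_) (operative-insertAt-false E i s)
operative-insertAt-false (e ∷ E) (suc i) (false ∷ s) = operative-insertAt-false E i s

operative-insertAt-true : (E : List (Edge A n)) (i : Fin (length E)) (s : State (removeAt E i)) →
                          operative E (insertAt E i true s) ↭ lookup E i ∷ operative (removeAt E i) s
operative-insertAt-true (e ∷ E) zero    s           = ↭-refl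
operative-insertAt-true (e ∷ E) (suc i) (true ∷ s)  =
  ↭-trans (prep e (operative-insertAt-true E i s)) (swap e (lookup E i) ↭-refl)
operative-insertAt-true (e ∷ E) (suc i) (false ∷ s) = operative-insertAt-true E i s

-- Needed because length (map h L) is not definitionally length L.

mapState : {B : Set a} (h : A → B) (L : List A) → Vec Bool (length L) → Vec Bool (length (map h L))
mapState h []      []      = []
mapState h (x ∷ L) (b ∷ s) = b ∷ mapState h L s

#on-mapState : {B : Set a} (h : A → B) (L : List A) (s : Vec Bool (length L)) →
               #on (mapState h L s) ≡ #on s
#on-mapState h []      []          = refl
#on-mapState h (x ∷ L) (true ∷ s)  = cong suc (#on-mapState h L s)
#on-mapState h (x ∷ L) (false ∷ s) = #on-mapState h L s

operative-mapState : (h : Edge A n → Edge A m) (L : List (Edge A n)) (s : State L) →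
                     operative (map h L) (mapState h L s) ≡ map h (operative L s)
operative-mapState h []      []          = refl
operative-mapState h (x ∷ L) (true ∷ s)  = cong (h x ∷_) (operative-mapState h L s)
operative-mapState h (x ∷ L) (false ∷ s) = operative-mapState h L s

record IsEdgeQuotient (x y : Fin n) (π : Fin n → Fin m) : Set where
  field
    identifies : π x ≡ π y
    fibres     : ∀ {a b} → π a ≡ π b → a ≡ b ⊎ (a ≡ x × b ≡ y) ⊎ (a ≡ y × b ≡ x)
    section    : Fin m → Fin n
    π∘section  : ∀ c → π (section c) ≡ c

module _ {m : ℕ} (x y : Fin (suc m)) (x≢y : x ≢ y) where

  punchIn∘merge : ∀ z → (z ≡ y × punchIn y (merge x y x≢y z) ≡ x) ⊎ (z ≢ y × punchIn y (merge x y x≢y z) ≡ z)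
  punchIn∘merge z with z FinP.≟ y
  ... | yes z≡y = inj₁ (z≡y , FinP.punchIn-punchOut _)
  ... | no  z≢y = inj₂ (z≢y , FinP.punchIn-punchOut _)

  merge-isEdgeQuotient : IsEdgeQuotient x y (merge x y x≢y)
  merge-isEdgeQuotient = record
    { identifies = identifies
    ; fibres     = fibres
    ; section    = punchIn y
    ; π∘section  = π∘section
    }
    where
    π = merge x y x≢y

    identifies : π x ≡ π y
    identifies with punchIn∘merge x | punchIn∘merge y
    ... | inj₁ (x≡y , _) | _              = ⊥-elim (x≢y x≡y)
    ... | _              | inj₂ (y≢y , _) = ⊥-elim (y≢y refl)
    ... | inj₂ (_ , πx)  | inj₁ (_ , πy)  = FinP.punchIn-injective y _ _ (≡.trans πx (≡.sym πy))

    fibres : ∀ {a b} → π a ≡ π b → a ≡ b ⊎ (a ≡ x × b ≡ y) ⊎ (a ≡ y × b ≡ x)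
    fibres {a} {b} πa≡πb with punchIn∘merge a | punchIn∘merge b | cong (punchIn y) πa≡πb
    ... | inj₁ (a≡y , _)  | inj₁ (b≡y , _)  | _  = inj₁ (≡.trans a≡y (≡.sym b≡y))
    ... | inj₁ (a≡y , πa) | inj₂ (_ , πb)   | eq = inj₂ (inj₂ (a≡y , ≡.trans (≡.sym πb) (≡.trans (≡.sym eq) πa)))
    ... | inj₂ (_ , πa)   | inj₁ (b≡y , πb) | eq = inj₂ (inj₁ (≡.trans (≡.sym πa) (≡.trans eq πb) , b≡y))
    ... | inj₂ (_ , πa)   | inj₂ (_ , πb)   | eq = inj₁ (≡.trans (≡.sym πa) (≡.trans eq πb))

    π∘section : ∀ c → π (punchIn y c) ≡ c
    π∘section c with punchIn∘merge (punchIn y c)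
    ... | inj₁ (p , _) = ⊥-elim (FinP.punchInᵢ≢i y c p)
    ... | inj₂ (_ , p) = FinP.punchIn-injective y _ _ p

quotient-isEdgeQuotient : (x y : Fin n) → IsEdgeQuotient x y (proj₂ (quotient x y))
quotient-isEdgeQuotient {suc m} x y with x FinP.≟ y
... | yes x≡y = record { identifies = x≡y ; fibres = inj₁ ; section = id ; π∘section = λ _ → refl }
... | no  x≢y = merge-isEdgeQuotient x y x≢y

module _ {e : Edge A n} {π : Fin n → Fin m} (isQuot : IsEdgeQuotient (u e) (v e) π) where
  open IsEdgeQuotient isQuot

  Adj-map : (F : List (Edge A n)) → ∀ {a b} → Adj F a b → Adj (map (mapEdge π) F) (π a) (π b)
  Adj-map (f ∷ F) (here (inj₁ (p , q))) = here (inj₁ (cong π p , cong π q))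
  Adj-map (f ∷ F) (here (inj₂ (p , q))) = here (inj₂ (cong π p , cong π q))
  Adj-map (f ∷ F) (there adj)           = there (Adj-map F adj)

  Adj-map⁻ : (F : List (Edge A n)) → ∀ {a′ b′} → Adj (map (mapEdge π) F) a′ b′ →
             ∃₂ λ a b → Adj F a b × π a ≡ a′ × π b ≡ b′
  Adj-map⁻ (f ∷ F) (here (inj₁ (p , q))) = u f , v f , here (inj₁ (refl , refl)) , p , q
  Adj-map⁻ (f ∷ F) (here (inj₂ (p , q))) = v f , u f , here (inj₂ (refl , refl)) , q , p
  Adj-map⁻ (f ∷ F) (there adj) with Adj-map⁻ F adj
  ... | a , b , ab , πa , πb = a , b , there ab , πa , πb

  Connected-fibre : (F : List (Edge A n)) → ∀ {a b} → π a ≡ π b → Connected (e ∷ F) a b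
  Connected-fibre F πa≡πb with fibres πa≡πb
  ... | inj₁ refl                = ε
  ... | inj₂ (inj₁ (refl , refl)) = here (inj₁ (refl , refl)) ◅ ε
  ... | inj₂ (inj₂ (refl , refl)) = here (inj₂ (refl , refl)) ◅ ε

  Connected-contract⁺ : (F : List (Edge A n)) → ∀ {a b} →
                        Connected (e ∷ F) a b → Connected (map (mapEdge π) F) (π a) (π b)
  Connected-contract⁺ F ε = ε
  Connected-contract⁺ F {b = b} (here (inj₁ (refl , refl)) ◅ r) =
    subst (λ z → Connected (map (mapEdge π) F) z (π b)) (≡.sym identifies) (Connected-contract⁺ F r)
  Connected-contract⁺ F {b = b} (here (inj₂ (refl , refl)) ◅ r) =
    subst (λ z → Connected (map (mapEdge π) F) z (π b)) identifies (Connected-contract⁺ F r)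
  Connected-contract⁺ F (there adj ◅ r) = Adj-map F adj ◅ Connected-contract⁺ F r

  Connected-contract⁻ : (F : List (Edge A n)) → ∀ {a b a′ b′} → π a ≡ a′ → π b ≡ b′ →
                        Connected (map (mapEdge π) F) a′ b′ → Connected (e ∷ F) a b
  Connected-contract⁻ F πa πb ε = Connected-fibre F (≡.trans πa (≡.sym πb))
  Connected-contract⁻ F πa πb (adj ◅ r) with Adj-map⁻ F adj
  ... | a₁ , b₁ , a₁b₁ , πa₁ , πb₁ =
    Connected-fibre F (≡.trans πa (≡.sym πa₁)) ◅◅ (there a₁b₁ ◅ Connected-contract⁻ F πb₁ πb r)

  Spans-contract : (F : List (Edge A n)) (K : List (Fin n)) →
                   Spans (e ∷ F) K ⇔ Spans (map (mapEdge π) F) (map π K)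
  Spans-contract F K = mk⇔
    (λ (c , cK) → π c , AllP.map⁺ (All.map (Connected-contract⁺ F) cK))
    (λ (c′ , c′K) → section c′ , All.map (Connected-contract⁻ F (π∘section c′) refl) (AllP.map⁻ c′K))

+suc≤⇔≤-1 : (k : ℕ) (l : ℤ) → (+ suc k ℤ.≤ l) ⇔ (+ k ℤ.≤ l -ℤ 1ℤ)
+suc≤⇔≤-1 k l = mk⇔
  (λ k<l → subst (+ k ℤ.≤_) (≡.sym l-1≡pred) (ℤP.i<j⇒i≤pred[j] (ℤP.suc[i]≤j⇒i<j k<l)))
  (λ k≤l-1 → ℤP.i<j⇒suc[i]≤j (ℤP.i≤pred[j]⇒i<j (subst (+ k ℤ.≤_) l-1≡pred k≤l-1)))
  where
  l-1≡pred : l -ℤ 1ℤ ≡ ℤ.pred l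
  l-1≡pred = ℤP.+-comm l ℤ.-1ℤ

module StateSums {c ℓ : Level} (R : CommutativeRing c ℓ) where
  open CommutativeRing R renaming (refl to ≈-refl)
  open Reliability R
  open import Relation.Binary.Reasoning.Setoid setoid
  open import Algebra.Properties.CommutativeSemigroup +-commutativeSemigroup using (interchange)
  open import Algebra.Properties.CommutativeSemigroup *-commutativeSemigroup using (x∙yz≈y∙xz)

  sumR-++ : (xs ys : List Carrier) → sumR (xs ++ ys) ≈ sumR xs + sumR ys
  sumR-++ []       ys = sym (+-identityˡ _)
  sumR-++ (x ∷ xs) ys = trans (+-congˡ (sumR-++ xs ys)) (sym (+-assoc _ _ _))

  sumR-map-cong : {X : Set} {f g : X → Carrier} → (∀ x → f x ≈ g x) → ∀ xs → sumR (map f xs) ≈ sumR (map g xs)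
  sumR-map-cong f≈g []       = ≈-refl
  sumR-map-cong f≈g (x ∷ xs) = +-cong (f≈g x) (sumR-map-cong f≈g xs)

  sumR-map-*ˡ : {X : Set} (p : Carrier) (f : X → Carrier) → ∀ xs → sumR (map (λ x → p * f x) xs) ≈ p * sumR (map f xs)
  sumR-map-*ˡ p f []       = sym (zeroʳ p)
  sumR-map-*ˡ p f (x ∷ xs) = trans (+-congˡ (sumR-map-*ˡ p f xs)) (sym (distribˡ p _ _))

  sumStates : (m : ℕ) → (Vec Bool m → Carrier) → Carrier
  sumStates m f = sumR (map f (allStates m))

  sumStates-suc : (m : ℕ) (f : Vec Bool (suc m) → Carrier) →
                  sumStates (suc m) f ≈ sumStates m (f ∘ (true ∷_)) + sumStates m (f ∘ (false ∷_))
  sumStates-suc m f = begin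
    sumR (map f (ts ++ fs))            ≡⟨ cong sumR (map-++ f ts fs) ⟩
    sumR (map f ts ++ map f fs)        ≈⟨ sumR-++ (map f ts) (map f fs) ⟩
    sumR (map f ts) + sumR (map f fs)  ≡⟨ cong₂ _+_ (cong sumR (≡.sym (map-∘ ss))) (cong sumR (≡.sym (map-∘ ss))) ⟩
    sumStates m (f ∘ (true ∷_)) + sumStates m (f ∘ (false ∷_)) ∎
    where
    ss = allStates m
    ts = map (true ∷_) ss
    fs = map (false ∷_) ss

  sumStates-insertAt : (E : List (Edge A n)) (i : Fin (length E)) (f : State E → Carrier) →
                       sumStates (length E) f ≈
                       sumStates (length (removeAt E i)) (f ∘ insertAt E i true)
                         + sumStates (length (removeAt E i)) (f ∘ insertAt E i false)
  sumStates-insertAt (e ∷ E) zero    f = sumStates-suc _ f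
  sumStates-insertAt (e ∷ E) (suc i) f = begin
    sumStates (suc (length E)) f
      ≈⟨ sumStates-suc _ f ⟩
    sumStates (length E) (f ∘ (true ∷_)) + sumStates (length E) (f ∘ (false ∷_))
      ≈⟨ +-cong (sumStates-insertAt E i (f ∘ (true ∷_))) (sumStates-insertAt E i (f ∘ (false ∷_))) ⟩
    (S (λ s → f (true ∷ insertAt E i true s)) + S (λ s → f (true ∷ insertAt E i false s)))
      + (S (λ s → f (false ∷ insertAt E i true s)) + S (λ s → f (false ∷ insertAt E i false s)))
      ≈⟨ interchange _ _ _ _ ⟩
    (S (λ s → f (true ∷ insertAt E i true s)) + S (λ s → f (false ∷ insertAt E i true s)))
      + (S (λ s → f (true ∷ insertAt E i false s)) + S (λ s → f (false ∷ insertAt E i false s)))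
      ≈⟨ +-cong (sumStates-suc L (f ∘ insertAt (e ∷ E) (suc i) true))
                (sumStates-suc L (f ∘ insertAt (e ∷ E) (suc i) false)) ⟨
    sumStates (suc L) (f ∘ insertAt (e ∷ E) (suc i) true)
      + sumStates (suc L) (f ∘ insertAt (e ∷ E) (suc i) false) ∎
    where
    L = length (removeAt E i)
    S = sumStates L

  sumStates-mapState : {B : Set a} (h : A → B) (L : List A) (g : Vec Bool (length (map h L)) → Carrier) →
                       sumStates (length (map h L)) g ≈ sumStates (length L) (g ∘ mapState h L)
  sumStates-mapState h []      g = ≈-refl
  sumStates-mapState h (x ∷ L) g = begin
    sumStates (suc (length (map h L))) g
      ≈⟨ sumStates-suc _ g ⟩
    sumStates _ (g ∘ (true ∷_)) + sumStates _ (g ∘ (false ∷_))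
      ≈⟨ +-cong (sumStates-mapState h L (g ∘ (true ∷_))) (sumStates-mapState h L (g ∘ (false ∷_))) ⟩
    sumStates _ (g ∘ (true ∷_) ∘ mapState h L) + sumStates _ (g ∘ (false ∷_) ∘ mapState h L)
      ≈⟨ sumStates-suc _ (g ∘ mapState h (x ∷ L)) ⟨
    sumStates (suc (length L)) (g ∘ mapState h (x ∷ L)) ∎

  bernoulli : Bool → Carrier → Carrier
  bernoulli true  p = p
  bernoulli false p = 1# - p

  weight-insertAt : (E : List (Edge Carrier n)) (i : Fin (length E)) (b : Bool) (s : State (removeAt E i)) →
                    weight E (insertAt E i b s) ≈ bernoulli b (prob (lookup E i)) * weight (removeAt E i) s
  weight-insertAt (e ∷ E) zero    true  s           = ≈-refl
  weight-insertAt (e ∷ E) zero    false s           = ≈-refl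
  weight-insertAt (e ∷ E) (suc i) b     (true ∷ s)  = trans (*-congˡ (weight-insertAt E i b s)) (x∙yz≈y∙xz _ _ _)
  weight-insertAt (e ∷ E) (suc i) b     (false ∷ s) = trans (*-congˡ (weight-insertAt E i b s)) (x∙yz≈y∙xz _ _ _)

  weight-mapState : (π : Fin n → Fin m) (L : List (Edge Carrier n)) (s : State L) →
                    weight (map (mapEdge π) L) (mapState (mapEdge π) L s) ≡ weight L s
  weight-mapState π []      []          = ≡.refl
  weight-mapState π (x ∷ L) (true ∷ s)  = cong (prob x *_) (weight-mapState π L s)
  weight-mapState π (x ∷ L) (false ∷ s) = cong ((1# - prob x) *_) (weight-mapState π L s)

  contribution : (E : List (Edge Carrier n)) → List (Fin n) → ℤ → State E → Carrier
  contribution E K l s = if does (kPathSet? E s K) ∧ does (+ #on s ℤ.≤? l) then weight E s else 0#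

  if-scale : {b b′ : Bool} {w w′ p : Carrier} → b ≡ b′ → w ≈ p * w′ →
             (if b then w else 0#) ≈ p * (if b′ then w′ else 0#)
  if-scale {true}  ≡.refl w≈pw′ = w≈pw′
  if-scale {false} ≡.refl _     = sym (zeroʳ _)

  contribution-failed : (E : List (Edge Carrier n)) (i : Fin (length E)) (K : List (Fin n)) (l : ℤ)
                        (s : State (removeAt E i)) →
                        contribution E K l (insertAt E i false s)
                          ≈ (1# - prob (lookup E i)) * contribution (removeAt E i) K l s
  contribution-failed E i K l s = if-scale (cong₂ _∧_ pathSet≡ count≡) (weight-insertAt E i false s)
    where
    pathSet≡ : does (kPathSet? E (insertAt E i false s) K) ≡ does (kPathSet? (removeAt E i) s K)
    pathSet≡ = does-⇔ (Spans-↭ (↭-reflexive (operative-insertAt-false E i s)))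
                      (kPathSet? E (insertAt E i false s) K) (kPathSet? (removeAt E i) s K)

    count≡ : does (+ #on (insertAt E i false s) ℤ.≤? l) ≡ does (+ #on s ℤ.≤? l)
    count≡ = cong (λ k → does (+ k ℤ.≤? l)) (#on-insertAt E i false s)

  contribution-operative : (E : List (Edge Carrier n)) (i : Fin (length E)) {π : Fin n → Fin m} →
                           IsEdgeQuotient (u (lookup E i)) (v (lookup E i)) π →
                           (K : List (Fin n)) (l : ℤ) (s : State (removeAt E i)) →
                           contribution E K l (insertAt E i true s)
                             ≈ prob (lookup E i) * contribution (map (mapEdge π) (removeAt E i)) (map π K) (l -ℤ 1ℤ)
                                                                (mapState (mapEdge π) (removeAt E i) s)
  contribution-operative E i {π} isQuot K l s =
    if-scale (cong₂ _∧_ pathSet≡ count≡)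
             (trans (weight-insertAt E i true s) (*-congˡ (reflexive (≡.sym (weight-mapState π L s)))))
    where
    L  = removeAt E i
    s′ = mapState (mapEdge π) L s

    pathSet≡ : does (kPathSet? E (insertAt E i true s) K) ≡ does (kPathSet? (map (mapEdge π) L) s′ (map π K))
    pathSet≡ = does-⇔ (Spans-↭ (↭-reflexive (≡.sym (operative-mapState (mapEdge π) L s)))
                        ⇔-∘ (Spans-contract isQuot (operative L s) K
                        ⇔-∘ Spans-↭ (operative-insertAt-true E i s)))
                      (kPathSet? E (insertAt E i true s) K) (kPathSet? (map (mapEdge π) L) s′ (map π K))

    count≡ : does (+ #on (insertAt E i true s) ℤ.≤? l) ≡ does (+ #on s′ ℤ.≤? l -ℤ 1ℤ)
    count≡ = ≡.trans (cong (λ k → does (+ k ℤ.≤? l)) (#on-insertAt E i true s))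
             (≡.trans (does-⇔ (+suc≤⇔≤-1 (#on s) l) (+ suc (#on s) ℤ.≤? l) (+ #on s ℤ.≤? l -ℤ 1ℤ))
                      (cong (λ k → does (+ k ℤ.≤? l -ℤ 1ℤ)) (≡.sym (#on-mapState (mapEdge π) L s))))

mainTheorem2 : ∀ {c ℓ : Level} (R : CommutativeRing c ℓ) →
    let open CommutativeRing R in
    let open Reliability R in
    (G : SGraph Carrier) → DistinctLabels G →
    (K : List (Fin (nodes G))) (l : ℤ) (i : Fin (length (edges G))) →
    Rel G K l ≈ (prob (lookup (edges G) i) * Rel (contract G i) (map (contractMap G i) K) (l -ℤ 1ℤ)
                 + (1# - prob (lookup (edges G) i)) * Rel (delete G i) K l)
mainTheorem2 R G _ K l i = begin
  Rel G K l
    ≈⟨ sumStates-insertAt E i (contribution E K l) ⟩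
  sumStates k (contribution E K l ∘ insertAt E i true) + sumStates k (contribution E K l ∘ insertAt E i false)
    ≈⟨ +-cong (sumR-map-cong (contribution-operative E i isQuot K l) (allStates k))
              (sumR-map-cong (contribution-failed E i K l) (allStates k)) ⟩
  sumStates k (λ s → p * contribution E′ (map π K) (l -ℤ 1ℤ) (mapState (mapEdge π) L s))
    + sumStates k (λ s → (1# - p) * contribution L K l s)
    ≈⟨ +-cong (sumR-map-*ˡ p _ (allStates k)) (sumR-map-*ˡ (1# - p) _ (allStates k)) ⟩
  p * sumStates k (contribution E′ (map π K) (l -ℤ 1ℤ) ∘ mapState (mapEdge π) L) + (1# - p) * Rel (delete G i) K l
    ≈⟨ +-congʳ (*-congˡ (sumStates-mapState (mapEdge π) L (contribution E′ (map π K) (l -ℤ 1ℤ)))) ⟨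
  p * Rel (contract G i) (map π K) (l -ℤ 1ℤ) + (1# - p) * Rel (delete G i) K l ∎
  where
  open CommutativeRing R
  open Reliability R
  open StateSums R
  open import Relation.Binary.Reasoning.Setoid setoid
  E  = edges G
  L  = removeAt E i
  k  = length L
  p  = prob (lookup E i)
  π  = contractMap G i
  E′ = map (mapEdge π) L
  isQuot = quotient-isEdgeQuotient (u (lookup E i)) (v (lookup E i))
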